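{- Let $3\leq m\leq n$. Then: (i) if $m$ is even, $\gamma_{MB}(P_m\square P_n)\leq \gamma_{MB}(P_2\square P_n)+\left(\frac{m}{2}-1\right)\gamma'_{MB}(P_2\square P_n)$; (ii) if $m$ and $n$ are odd, $\gamma_{MB}(P_m\square P_n)\leq \gamma_{MB}(P_n)+\left\lfloor\frac{m}{2}\right\rfloor\gamma'_{MB}(P_2\square P_n)$; (iii) if $m$ is odd and $n$ is even, $\gamma_{MB}(P_m\square P_n)\leq \gamma_{MB}(P_2\square P_m)+\left(\frac{n}{2}-1\right)\gamma'_{MB}(P_2\square P_m)$.
   Context: $P_k$ is the path on $k$ vertices and $\square$ the Cartesian product. In the Maker–Breaker domination game on a graph $G$, two players, Dominator and Staller, alternately claim previously unclaimed vertices of $G$. Dominator wins if the set of vertices he claims becomes a dominating set of $G$ (every vertex not in it has a neighbour in it); Staller wins if she claims some vertex together with all of its neighbours. In the $D$-game Dominator moves first, in the $S$-game Staller moves first. $\gamma_{MB}(G)$ is the minimum number of moves Dominator needs to win the $D$-game on $G$ against optimal play by Staller (who tries to postpone his win), and $\gamma'_{MB}(G)$ the analogous quantity for the $S$-game. -}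

module Defs where

open import Data.Nat using (ℕ; zero; suc; _+_; _*_; _≟_)
open import Data.Bool using (Bool; true; false; _∧_; _∨_; not; if_then_else_)
open import Data.List using (List; []; _∷_; length; map; concatMap)
open import Data.Bool.ListAction using (all; any)
open import Data.Fin using (Fin; toℕ)
open import Data.List using () renaming (map to lmap)
open import Data.Fin using () renaming (_≟_ to _≟F_)
open import Data.List.Base using (allFin)
open import Data.Product using (_×_; _,_)
open import Data.Product.Properties using (≡-dec)
open import Relation.Binary.Definitions using (DecidableEquality)
open import Relation.Nullary.Decidable using (⌊_⌋)

-- Finite simple graphs given by an explicit vertex list (without
-- repetitions), a symmetric irreflexive Boolean adjacency and decidable
-- equality on vertices.

record Graph : Set₁ where
  field
    V     : Set
    verts : List V
    adj   : V → V → Bool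
    eq?   : DecidableEquality V

P : ℕ → Graph
P k = record
  { V = Fin k
  ; verts = allFin k
  ; adj = λ i j → ⌊ suc (toℕ i) ≟ toℕ j ⌋ ∨ ⌊ suc (toℕ j) ≟ toℕ i ⌋
  ; eq? = _≟F_
  }

infixl 7 _□_
_□_ : Graph → Graph → Graph
G □ H = record
  { V = G.V × H.V
  ; verts = concatMap (λ g → lmap (λ h → g , h) H.verts) G.verts
  ; adj = λ { (g , h) (g' , h') →
        (⌊ G.eq? g g' ⌋ ∧ H.adj h h') ∨ (⌊ H.eq? h h' ⌋ ∧ G.adj g g') }
  ; eq? = ≡-dec G.eq? H.eq?
  }
  where
    module G = Graph G
    module H = Graph H

-- ℕ ∪ {∞}  (∞ = Staller wins, so Dominator never completes a dominating set)

data ℕ∞ : Set where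
  fin : ℕ → ℕ∞
  ∞   : ℕ∞

infixl 6 _+∞_
_+∞_ : ℕ∞ → ℕ∞ → ℕ∞
fin a +∞ fin b = fin (a + b)
_     +∞ _     = ∞

infixl 7 _·∞_
-- scalar multiple c · x  (convention 0 · ∞ = 0; irrelevant here as c ≥ 1)
_·∞_ : ℕ → ℕ∞ → ℕ∞
zero  ·∞ x = fin 0
suc c ·∞ x = x +∞ (c ·∞ x)

min∞ : ℕ∞ → ℕ∞ → ℕ∞
min∞ (fin zero)    _             = fin zero
min∞ (fin (suc a)) (fin zero)    = fin zero
min∞ (fin (suc a)) (fin (suc b)) with min∞ (fin a) (fin b)
... | fin c = fin (suc c)
... | ∞     = ∞
min∞ (fin a)       ∞             = fin a
min∞ ∞             y             = y

max∞ : ℕ∞ → ℕ∞ → ℕ∞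
max∞ (fin zero)    y             = y
max∞ (fin (suc a)) (fin zero)    = fin (suc a)
max∞ (fin (suc a)) (fin (suc b)) with max∞ (fin a) (fin b)
... | fin c = fin (suc c)
... | ∞     = ∞
max∞ (fin a)       ∞             = ∞
max∞ ∞             y             = ∞

infix 4 _≤∞_
data _≤∞_ : ℕ∞ → ℕ∞ → Set where
  fin≤fin : ∀ {a b} → a Data.Nat.≤ b → fin a ≤∞ fin b
  x≤∞     : ∀ {x} → x ≤∞ ∞

module Game (G : Graph) where
  open Graph G

  elem : V → List V → Bool
  elem v xs = any (λ u → ⌊ eq? v u ⌋) xs

  dominates : List V → Bool
  dominates D = all (λ v → elem v D ∨ any (λ u → adj v u ∧ elem u D) verts) verts

  isolates : List V → Bool
  isolates S = any (λ v → elem v S ∧ all (λ u → not (adj v u) ∨ elem u S) verts) verts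

  isFree : List V → List V → V → Bool
  isFree D S v = not (elem v D ∨ elem v S)

  minOver : (V → ℕ∞) → List V → ℕ∞
  minOver f []       = ∞
  minOver f (v ∷ vs) = min∞ (f v) (minOver f vs)

  maxOver : (V → ℕ∞) → List V → ℕ∞
  maxOver f []       = fin 0
  maxOver f (v ∷ vs) = max∞ (f v) (maxOver f vs)

  -- value fuel dTurn D S : number of further moves Dominator needs to
  -- win (∞ if Staller wins) under optimal play from the position where
  -- Dominator has claimed D, Staller has claimed S, and dTurn says whether
  -- it is Dominator's turn.  Dominator minimises, Staller maximises.
  -- fuel bounds the number of remaining moves (= number of free vertices).
  value : ℕ → Bool → List V → List V → ℕ∞
  value fuel dTurn D S =
    if dominates D then fin 0 else
    if isolates S then ∞ else step fuel dTurn
    where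
      step : ℕ → Bool → ℕ∞
      step zero     _     = ∞
      step (suc f)  true  =
        if any (isFree D S) verts
        then fin 1 +∞ minOver (λ v → if isFree D S v then value f false (v ∷ D) S else ∞) verts
        else ∞
      step (suc f)  false =
        if any (isFree D S) verts
        then maxOver (λ v → if isFree D S v then value f true D (v ∷ S) else fin 0) verts
        else ∞

-- γ_MB(G): D-game (Dominator starts);  γ'_MB(G): S-game (Staller starts).
γMB : Graph → ℕ∞
γMB G = Game.value G (length (Graph.verts G)) true [] []

γ'MB : Graph → ℕ∞
γ'MB G = Game.value G (length (Graph.verts G)) false [] []

module Submission where

-- Suppose the
-- vertex set of G is partitioned into parts H₀, H₁, …, H_c, each embedded
-- in G as a (not necessarily induced) subgraph.  Dominator fixes an
-- optimal D-game strategy on H₀ and optimal S-game strategies on H₁ … H_c.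
-- He opens on H₀ and afterwards always answers in the part where Staller
-- has just played; if that part is already dominated, he answers an
-- imaginary Staller move in some part that is not.  Dominating every part
-- dominates G, so  γ_MB(G) ≤ γ_MB(H₀) + γ'_MB(H₁) + … + γ'_MB(H_c).

open import Defs
open import Data.Nat using (ℕ; _≤_; _∸_)
open import Data.Nat.DivMod using (_/_)
open import Data.Nat.Divisibility using (_∣_)
open import Data.Product using (_×_)
open import Relation.Nullary using (¬_)

open import Data.Nat using (zero; suc; _+_; _*_; _<_; z≤n; s≤s; _⊓_; _⊔_)
import Data.Nat.Properties as ℕₚ
open import Data.Nat.DivMod using (_%_; m≡m%n+[m/n]*n; m%n<n; m/n*n≡m; m<n*o⇒m/o<n)
open import Data.Nat.Divisibility using (m%n≡0⇒n∣m)
open import Data.Bool using (Bool; true; false; _∧_; _∨_; not; if_then_else_; _≟_)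
open import Data.Bool.Properties using (¬-not; ∨-comm)
open import Data.Bool.ListAction using (all; any)
open import Data.List using (List; []; _∷_; length; map)
open import Data.List.Membership.Propositional using (_∈_; lose)
open import Data.List.Membership.Propositional.Properties using (∈-allFin; ∈-map⁺; ∈-concatMap⁺)
open import Data.List.Relation.Unary.Any using (here; there)
open import Data.Fin using (Fin; toℕ; fromℕ<) renaming (zero to fzero; suc to fsuc)
import Data.Fin.Properties as Finₚ
open import Data.Vec.Functional using (Vector; foldr; updateAt; head; tail)
open import Data.Vec.Functional.Properties using (updateAt-updates; updateAt-minimal)
open import Data.Product using (Σ; ∃-syntax; _,_; proj₁; proj₂)
open import Data.Sum using (_⊎_; inj₁; inj₂)
open import Data.Empty using (⊥; ⊥-elim)
open import Function using (_∘_; const)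
open import Relation.Binary.PropositionalEquality using (_≡_; _≢_; refl; sym; trans; cong; cong₂; subst; module ≡-Reasoning)
open import Relation.Nullary.Decidable using (Dec; yes; no; ⌊_⌋)

true≢false : true ≢ false
true≢false ()

true-or-false : ∀ b → b ≡ true ⊎ b ≡ false
true-or-false true  = inj₁ refl
true-or-false false = inj₂ refl

∨-true⁻ : ∀ {a b} → a ∨ b ≡ true → a ≡ true ⊎ b ≡ true
∨-true⁻ {true}  _ = inj₁ refl
∨-true⁻ {false} e = inj₂ e

∨-trueˡ : ∀ {a} b → a ≡ true → a ∨ b ≡ true
∨-trueˡ b refl = refl

∨-trueʳ : ∀ a {b} → b ≡ true → a ∨ b ≡ true
∨-trueʳ true  _ = refl
∨-trueʳ false e = e

∨-true-mapʳ : ∀ {a b c} → a ∨ b ≡ true → (b ≡ true → c ≡ true) → a ∨ c ≡ true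
∨-true-mapʳ {true}  _ _ = refl
∨-true-mapʳ {false} e f = f e

∧-true⁻ : ∀ {a b} → a ∧ b ≡ true → a ≡ true × b ≡ true
∧-true⁻ {true} {true} _ = refl , refl

∧-true⁺ : ∀ {a b} → a ≡ true → b ≡ true → a ∧ b ≡ true
∧-true⁺ refl refl = refl

⌊⌋-cong : ∀ {A B : Set} → (A → B) → (B → A) → (a? : Dec A) (b? : Dec B) → ⌊ a? ⌋ ≡ ⌊ b? ⌋
⌊⌋-cong f g (yes a) (yes b) = refl
⌊⌋-cong f g (yes a) (no ¬b) = ⊥-elim (¬b (f a))
⌊⌋-cong f g (no ¬a) (yes b) = ⊥-elim (¬a (g b))
⌊⌋-cong f g (no ¬a) (no ¬b) = refl

⌊⌋-false : ∀ {A : Set} (a? : Dec A) → ¬ A → ⌊ a? ⌋ ≡ false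
⌊⌋-false (yes a) ¬a = ⊥-elim (¬a a)
⌊⌋-false (no _)  _  = refl

⌊⌋-true⁻ : ∀ {A : Set} (a? : Dec A) → ⌊ a? ⌋ ≡ true → A
⌊⌋-true⁻ (yes a) _ = a

module _ {A : Set} where

  any-intro : ∀ (f : A → Bool) xs {x} → x ∈ xs → f x ≡ true → any f xs ≡ true
  any-intro f (y ∷ ys) (here refl) e = ∨-trueˡ _ e
  any-intro f (y ∷ ys) (there x∈) e = ∨-trueʳ (f y) (any-intro f ys x∈ e)

  any-elim : ∀ (f : A → Bool) xs → any f xs ≡ true → ∃[ x ] x ∈ xs × f x ≡ true
  any-elim f (y ∷ ys) e with ∨-true⁻ {f y} e
  ... | inj₁ fy = y , here refl , fy
  ... | inj₂ rest with any-elim f ys rest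
  ...   | x , x∈ , fx = x , there x∈ , fx

  all-intro : ∀ (f : A → Bool) xs → (∀ x → x ∈ xs → f x ≡ true) → all f xs ≡ true
  all-intro f []       h = refl
  all-intro f (y ∷ ys) h = ∧-true⁺ (h y (here refl)) (all-intro f ys (λ x x∈ → h x (there x∈)))

  all-elim : ∀ (f : A → Bool) xs {x} → all f xs ≡ true → x ∈ xs → f x ≡ true
  all-elim f (y ∷ ys) e (here refl) = proj₁ (∧-true⁻ {f y} e)
  all-elim f (y ∷ ys) e (there x∈) = all-elim f ys (proj₂ (∧-true⁻ {f y} e)) x∈

  any-cong : ∀ (f g : A → Bool) xs → (∀ x → f x ≡ g x) → any f xs ≡ any g xs
  any-cong f g []       h = refl
  any-cong f g (y ∷ ys) h = cong₂ _∨_ (h y) (any-cong f g ys h)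

  all-cong : ∀ (f g : A → Bool) xs → (∀ x → f x ≡ g x) → all f xs ≡ all g xs
  all-cong f g []       h = refl
  all-cong f g (y ∷ ys) h = cong₂ _∧_ (h y) (all-cong f g ys h)

  any-mono : ∀ (f g : A → Bool) xs → (∀ x → f x ≡ true → g x ≡ true) → any f xs ≡ true → any g xs ≡ true
  any-mono f g xs h e with any-elim f xs e
  ... | x , x∈ , fx = any-intro g xs x∈ (h x fx)

  countᵇ : (A → Bool) → List A → ℕ
  countᵇ f []       = 0
  countᵇ f (x ∷ xs) = (if f x then 1 else 0) + countᵇ f xs

  countᵇ-mono : ∀ (f g : A → Bool) xs → (∀ v → g v ≡ true → f v ≡ true) → countᵇ g xs ≤ countᵇ f xs
  countᵇ-mono f g []       h = z≤n
  countᵇ-mono f g (x ∷ xs) h with g x in gx | f x in fx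
  ... | false | false = countᵇ-mono f g xs h
  ... | false | true  = ℕₚ.m≤n⇒m≤1+n (countᵇ-mono f g xs h)
  ... | true  | true  = s≤s (countᵇ-mono f g xs h)
  ... | true  | false = ⊥-elim (true≢false (trans (sym (h x gx)) fx))

  countᵇ-strict : ∀ (f g : A → Bool) xs → (∀ v → g v ≡ true → f v ≡ true) →
                  ∀ {x} → x ∈ xs → f x ≡ true → g x ≡ false → countᵇ g xs < countᵇ f xs
  countᵇ-strict f g (x ∷ xs) h (here refl) fx gx rewrite fx | gx = s≤s (countᵇ-mono f g xs h)
  countᵇ-strict f g (y ∷ xs) h (there x∈) fx gx with g y in gy | f y in fy
  ... | false | false = countᵇ-strict f g xs h x∈ fx gx
  ... | false | true  = ℕₚ.m≤n⇒m≤1+n (countᵇ-strict f g xs h x∈ fx gx)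
  ... | true  | true  = s≤s (countᵇ-strict f g xs h x∈ fx gx)
  ... | true  | false = ⊥-elim (true≢false (trans (sym (h y gy)) fy))

  countᵇ-pos : ∀ (f : A → Bool) xs {x} → x ∈ xs → f x ≡ true → 0 < countᵇ f xs
  countᵇ-pos f xs x∈ fx = ℕₚ.≤-trans (s≤s z≤n) (countᵇ-strict f (const false) xs (λ _ ()) x∈ fx refl)

  countᵇ≤length : ∀ (f : A → Bool) xs → countᵇ f xs ≤ length xs
  countᵇ≤length f []       = z≤n
  countᵇ≤length f (x ∷ xs) with f x
  ... | true  = s≤s (countᵇ≤length f xs)
  ... | false = ℕₚ.m≤n⇒m≤1+n (countᵇ≤length f xs)

∞≰fin : ∀ {k} → ∞ ≤∞ fin k → ⊥
∞≰fin ()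

fin-≤⁻ : ∀ {a k} → fin a ≤∞ fin k → a ≤ k
fin-≤⁻ (fin≤fin a≤k) = a≤k

≤∞-refl : ∀ {x} → x ≤∞ x
≤∞-refl {fin a} = fin≤fin ℕₚ.≤-refl
≤∞-refl {∞}     = x≤∞

≤∞-trans : ∀ {x y z} → x ≤∞ y → y ≤∞ z → x ≤∞ z
≤∞-trans (fin≤fin p) (fin≤fin q) = fin≤fin (ℕₚ.≤-trans p q)
≤∞-trans _           x≤∞         = x≤∞

min∞-fin : ∀ a b → min∞ (fin a) (fin b) ≡ fin (a ⊓ b)
min∞-fin zero    b       = refl
min∞-fin (suc a) zero    = refl
min∞-fin (suc a) (suc b) rewrite min∞-fin a b = refl

max∞-fin : ∀ a b → max∞ (fin a) (fin b) ≡ fin (a ⊔ b)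
max∞-fin zero    b       = refl
max∞-fin (suc a) zero    = refl
max∞-fin (suc a) (suc b) rewrite max∞-fin a b = refl

min∞-≤⁻ : ∀ x y {k} → min∞ x y ≤∞ fin k → x ≤∞ fin k ⊎ y ≤∞ fin k
min∞-≤⁻ (fin a)       (fin b) h rewrite min∞-fin a b with ℕₚ.≤-total a b
... | inj₁ a≤b = inj₁ (fin≤fin (subst (_≤ _) (ℕₚ.m≤n⇒m⊓n≡m a≤b) (fin-≤⁻ h)))
... | inj₂ b≤a = inj₂ (fin≤fin (subst (_≤ _) (ℕₚ.m≥n⇒m⊓n≡n b≤a) (fin-≤⁻ h)))
min∞-≤⁻ (fin zero)    ∞ h = inj₁ h
min∞-≤⁻ (fin (suc a)) ∞ h = inj₁ h
min∞-≤⁻ ∞             y h = inj₂ h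

min∞-≤ˡ : ∀ x y {k} → x ≤∞ fin k → min∞ x y ≤∞ fin k
min∞-≤ˡ (fin a)       (fin b) (fin≤fin a≤k) rewrite min∞-fin a b = fin≤fin (ℕₚ.≤-trans (ℕₚ.m⊓n≤m a b) a≤k)
min∞-≤ˡ (fin zero)    ∞       h = h
min∞-≤ˡ (fin (suc a)) ∞       h = h

min∞-≤ʳ : ∀ x y {k} → y ≤∞ fin k → min∞ x y ≤∞ fin k
min∞-≤ʳ (fin a) (fin b) (fin≤fin b≤k) rewrite min∞-fin a b = fin≤fin (ℕₚ.≤-trans (ℕₚ.m⊓n≤n a b) b≤k)
min∞-≤ʳ ∞       y       h = h

max∞-≤⁻ : ∀ x y {k} → max∞ x y ≤∞ fin k → x ≤∞ fin k × y ≤∞ fin k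
max∞-≤⁻ (fin a)       (fin b) h rewrite max∞-fin a b =
  fin≤fin (ℕₚ.≤-trans (ℕₚ.m≤m⊔n a b) (fin-≤⁻ h)) , fin≤fin (ℕₚ.≤-trans (ℕₚ.m≤n⊔m a b) (fin-≤⁻ h))
max∞-≤⁻ (fin zero)    ∞ ()
max∞-≤⁻ (fin (suc a)) ∞ ()
max∞-≤⁻ ∞             y ()

max∞-≤⁺ : ∀ x y {k} → x ≤∞ fin k → y ≤∞ fin k → max∞ x y ≤∞ fin k
max∞-≤⁺ (fin a) (fin b) (fin≤fin a≤k) (fin≤fin b≤k) rewrite max∞-fin a b = fin≤fin (ℕₚ.⊔-lub a≤k b≤k)

1+∞-≤⁻ : ∀ x {k} → fin 1 +∞ x ≤∞ fin k → ∃[ k' ] k ≡ suc k' × x ≤∞ fin k'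
1+∞-≤⁻ (fin a) {suc k} (fin≤fin (s≤s a≤k)) = k , refl , fin≤fin a≤k

1+∞-≤⁺ : ∀ x {k} → x ≤∞ fin k → fin 1 +∞ x ≤∞ fin (suc k)
1+∞-≤⁺ (fin a) (fin≤fin a≤k) = fin≤fin (s≤s a≤k)

·∞-fin : ∀ c b → c ·∞ fin b ≡ fin (c * b)
·∞-fin zero    b = refl
·∞-fin (suc c) b rewrite ·∞-fin c b = refl

+∞-·∞-bound : ∀ c x y {g} → (∀ a b → x ≤∞ fin a → (0 < c → y ≤∞ fin b) → g ≤∞ fin (a + c * b)) →
              g ≤∞ x +∞ c ·∞ y
+∞-·∞-bound c       ∞       y       h = x≤∞
+∞-·∞-bound c       (fin a) (fin b) h rewrite ·∞-fin c b = h a b ≤∞-refl (λ _ → ≤∞-refl)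
+∞-·∞-bound zero    (fin a) ∞       h = h a 0 ≤∞-refl (λ ())
+∞-·∞-bound (suc c) (fin a) ∞       h = x≤∞

-- Sets of claimed vertices are boolean
-- predicates on V; `DWin k p q` says that Dominator, holding p and to
-- move against Staller holding q, can force p to become dominating
-- within k of his moves, and `SWin k p q` says the same with Staller to
-- move.  As in Defs, a position where Staller is to move but no vertex is
-- free (and p does not dominate) does not count as a win for Dominator.

module Play (G : Graph) where
  open Graph G

  VSet : Set
  VSet = V → Bool

  ∅ : VSet
  ∅ _ = false

  insert : V → VSet → VSet
  insert x p v = ⌊ eq? v x ⌋ ∨ p v

  dominated : VSet → Bool
  dominated p = all (λ v → p v ∨ any (λ u → adj v u ∧ p u) verts) verts

  free : VSet → VSet → V → Bool
  free p q v = not (p v ∨ q v)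

  isolating : VSet → Bool
  isolating q = any (λ v → q v ∧ all (λ u → not (adj v u) ∨ q u) verts) verts

  DWin GoodMove SWin : ℕ → VSet → VSet → Set
  DWin k p q = dominated p ≡ true ⊎ GoodMove k p q
  GoodMove zero    p q = ⊥
  GoodMove (suc k) p q = ∃[ x ] x ∈ verts × free p q x ≡ true × SWin k (insert x p) q
  SWin k p q = dominated p ≡ true
             ⊎ any (free p q) verts ≡ true × (∀ y → y ∈ verts → free p q y ≡ true → DWin k p (insert y q))

  _≐_ _⊆_ : VSet → VSet → Set
  p ≐ p' = ∀ v → p v ≡ p' v
  p ⊆ p' = ∀ v → p v ≡ true → p' v ≡ true

  dominated-cong : ∀ {p p'} → p ≐ p' → dominated p ≡ dominated p'
  dominated-cong e = all-cong _ _ verts λ v → cong₂ _∨_ (e v) (any-cong _ _ verts λ u → cong (adj v u ∧_) (e u))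

  free-cong : ∀ {p p' q q'} → p ≐ p' → q ≐ q' → ∀ v → free p q v ≡ free p' q' v
  free-cong e f v = cong not (cong₂ _∨_ (e v) (f v))

  insert-cong : ∀ x {p p'} → p ≐ p' → insert x p ≐ insert x p'
  insert-cong x e v = cong (⌊ eq? v x ⌋ ∨_) (e v)

  DWin-cong : ∀ k {p p' q q'} → p ≐ p' → q ≐ q' → DWin k p q → DWin k p' q'
  SWin-cong : ∀ k {p p' q q'} → p ≐ p' → q ≐ q' → SWin k p q → SWin k p' q'
  DWin-cong k       e f (inj₁ d) = inj₁ (trans (sym (dominated-cong e)) d)
  DWin-cong zero    e f (inj₂ ())
  DWin-cong (suc k) e f (inj₂ (x , x∈ , fx , s)) =
    inj₂ (x , x∈ , trans (sym (free-cong e f x)) fx , SWin-cong k (insert-cong x e) f s)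
  SWin-cong k e f (inj₁ d) = inj₁ (trans (sym (dominated-cong e)) d)
  SWin-cong k e f (inj₂ (some , h)) =
    inj₂ ( trans (sym (any-cong _ _ verts (free-cong e f))) some
         , λ y y∈ fy → DWin-cong k e (insert-cong y f) (h y y∈ (trans (free-cong e f y) fy)))

  ⊆-insert : ∀ y {q} → q ⊆ insert y q
  ⊆-insert y v e = ∨-trueʳ _ e

  insert-mono : ∀ y {q q'} → q ⊆ q' → insert y q ⊆ insert y q'
  insert-mono y s v e with ∨-true⁻ {⌊ eq? v y ⌋} e
  ... | inj₁ v≡y = ∨-trueˡ _ v≡y
  ... | inj₂ qv  = ∨-trueʳ _ (s v qv)

  insert-absorb : ∀ y {q q'} → q ⊆ q' → q' y ≡ true → insert y q ⊆ q'
  insert-absorb y {q' = q'} s q'y v e with ∨-true⁻ {⌊ eq? v y ⌋} e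
  ... | inj₁ v≡y = subst (λ w → q' w ≡ true) (sym (⌊⌋-true⁻ (eq? v y) v≡y)) q'y
  ... | inj₂ qv  = s v qv

  free-antitone : ∀ {p q q'} → q ⊆ q' → ∀ v → free p q' v ≡ true → free p q v ≡ true
  free-antitone {p} {q} {q'} s v fv with p v | q v | q' v | s v
  ... | true  | _     | _     | _ = fv
  ... | false | false | _     | _ = refl
  ... | false | true  | true  | _ = fv
  ... | false | true  | false | g = ⊥-elim (true≢false (sym (g refl)))

  -- When Staller
  -- plays a vertex y that is free now but taken in the larger position,
  -- Dominator answers as if she had played some vertex that is free there.
  DWin-antitone : ∀ k {p q q'} → q ⊆ q' → DWin k p q' → DWin k p q
  GoodMove-antitone : ∀ k {p q q'} → q ⊆ q' → GoodMove k p q' → GoodMove k p q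
  SWin-antitone : ∀ k {p q q'} → q ⊆ q' → SWin k p q' → SWin k p q
  DWin-antitone k s (inj₁ d)  = inj₁ d
  DWin-antitone k s (inj₂ mv) = inj₂ (GoodMove-antitone k s mv)
  GoodMove-antitone zero    s ()
  GoodMove-antitone (suc k) {p} s (x , x∈ , fx , w) = x , x∈ , free-antitone {p} s x fx , SWin-antitone k s w
  SWin-antitone k s (inj₁ d) = inj₁ d
  SWin-antitone k {p} {q} {q'} s (inj₂ (some , h)) = inj₂ (any-mono _ _ verts (free-antitone {p} s) some , answer)
    where
    answer : ∀ y → y ∈ verts → free p q y ≡ true → DWin k p (insert y q)
    answer y y∈ fy with q' y in q'y
    ... | false = DWin-antitone k (insert-mono y s) (h y y∈ (free-in-q' fy))
      where
      free-in-q' : free p q y ≡ true → free p q' y ≡ true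
      free-in-q' f with p y
      ... | false = cong not q'y
      ... | true  = f
    ... | true with any-elim _ verts some
    ...   | z , z∈ , fz = DWin-antitone k (insert-absorb y (λ v e → ⊆-insert z {q'} v (s v e)) (⊆-insert z {q'} y q'y)) (h z z∈ fz)

  Disjoint : VSet → VSet → Set
  Disjoint p q = ∀ v → p v ≡ true → q v ≡ true → ⊥

  -- A dominating set meets every closed neighbourhood.
  dominated⇒¬isolating : ∀ {p q} → dominated p ≡ true → Disjoint p q → isolating q ≡ true → ⊥
  dominated⇒¬isolating {p} {q} d dj i with any-elim _ verts i
  ... | v , v∈ , nv with ∧-true⁻ {q v} nv
  ... | qv , closed with ∨-true⁻ {p v} (all-elim _ verts d v∈)
  ... | inj₁ pv = dj v pv qv
  ... | inj₂ nb with any-elim _ verts nb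
  ... | u , u∈ , au with ∧-true⁻ {adj v u} au
  ... | vu , pu with ∨-true⁻ {not (adj v u)} (all-elim _ verts closed u∈)
  ... | inj₁ ¬vu rewrite vu = true≢false (sym ¬vu)
  ... | inj₂ qu = dj u pu qu

  isolating-mono : ∀ {q q'} → q ⊆ q' → isolating q ≡ true → isolating q' ≡ true
  isolating-mono {q} s = any-mono _ _ verts λ v e →
    let qv , closed = ∧-true⁻ {q v} e
    in ∧-true⁺ (s v qv) (all-intro _ verts λ u u∈ → ∨-true-mapʳ {not (adj v u)} (all-elim _ verts closed u∈) (s u))

  Disjoint-insertˡ : ∀ {p q} x → free p q x ≡ true → Disjoint p q → Disjoint (insert x p) q
  Disjoint-insertˡ {p} {q} x fx dj v a b with ∨-true⁻ {⌊ eq? v x ⌋} a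
  ... | inj₂ pv = dj v pv b
  ... | inj₁ e with ⌊⌋-true⁻ (eq? v x) e
  ... | refl with p v
  ... | false rewrite b = true≢false (sym fx)
  ... | true  = true≢false (sym fx)

  Disjoint-insertʳ : ∀ {p q} y → free p q y ≡ true → Disjoint p q → Disjoint p (insert y q)
  Disjoint-insertʳ {p} {q} y fy dj v a b with ∨-true⁻ {⌊ eq? v y ⌋} b
  ... | inj₂ qv = dj v a qv
  ... | inj₁ e with ⌊⌋-true⁻ (eq? v y) e
  ... | refl rewrite a = true≢false (sym fy)

  DWin⇒¬isolating : ∀ k {p q} → DWin k p q → Disjoint p q → isolating q ≡ true → ⊥
  SWin⇒¬isolating : ∀ k {p q} → SWin k p q → Disjoint p q → isolating q ≡ true → ⊥
  DWin⇒¬isolating k       (inj₁ d) dj i = dominated⇒¬isolating d dj i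
  DWin⇒¬isolating zero    (inj₂ ()) dj i
  DWin⇒¬isolating (suc k) (inj₂ (x , _ , fx , w)) dj i = SWin⇒¬isolating k w (Disjoint-insertˡ x fx dj) i
  SWin⇒¬isolating k (inj₁ d) dj i = dominated⇒¬isolating d dj i
  SWin⇒¬isolating k (inj₂ (some , h)) dj i with any-elim _ verts some
  ... | y , y∈ , fy = DWin⇒¬isolating k (h y y∈ fy) (Disjoint-insertʳ y fy dj) (isolating-mono (⊆-insert y) i)

module Adequacy (G : Graph) where
  open Graph G
  open Game G
  open Play G

  ⟦_⟧ : List V → VSet
  ⟦ D ⟧ v = elem v D

  if-dominated : ∀ {R : Set} b {y k} → (if b then fin 0 else y) ≤∞ fin k → (b ≡ true → R) → (y ≤∞ fin k → R) → R
  if-dominated true  h won go = won refl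
  if-dominated false h won go = go h

  if-dominated⁺ : ∀ b {y k} → (b ≡ false → y ≤∞ fin k) → (if b then fin 0 else y) ≤∞ fin k
  if-dominated⁺ true  h = fin≤fin z≤n
  if-dominated⁺ false h = h refl

  if-lost : ∀ b {y k} → (if b then ∞ else y) ≤∞ fin k → y ≤∞ fin k
  if-lost false h = h

  if-lost⁺ : ∀ b {y k} → b ≡ false → y ≤∞ fin k → (if b then ∞ else y) ≤∞ fin k
  if-lost⁺ false _ h = h

  if-available : ∀ b {y k} → (if b then y else ∞) ≤∞ fin k → b ≡ true × y ≤∞ fin k
  if-available true h = refl , h

  if-available⁺ : ∀ b {y k} → b ≡ true → y ≤∞ fin k → (if b then y else ∞) ≤∞ fin k
  if-available⁺ true _ h = h

  if-chosen : ∀ b {y z k} → b ≡ true → (if b then y else z) ≤∞ fin k → y ≤∞ fin k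
  if-chosen true _ h = h

  if-chosen⁺ : ∀ b {y k} → (b ≡ true → y ≤∞ fin k) → (if b then y else fin 0) ≤∞ fin k
  if-chosen⁺ true  h = h refl
  if-chosen⁺ false h = fin≤fin z≤n

  minOver-≤⁻ : ∀ g xs {k} → minOver g xs ≤∞ fin k → ∃[ x ] x ∈ xs × g x ≤∞ fin k
  minOver-≤⁻ g (x ∷ xs) h with min∞-≤⁻ (g x) (minOver g xs) h
  ... | inj₁ gx = x , here refl , gx
  ... | inj₂ rest with minOver-≤⁻ g xs rest
  ...   | y , y∈ , gy = y , there y∈ , gy

  minOver-≤⁺ : ∀ g xs {k x} → x ∈ xs → g x ≤∞ fin k → minOver g xs ≤∞ fin k
  minOver-≤⁺ g (y ∷ xs) (here refl) e = min∞-≤ˡ (g y) (minOver g xs) e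
  minOver-≤⁺ g (y ∷ xs) (there x∈) e = min∞-≤ʳ (g y) (minOver g xs) (minOver-≤⁺ g xs x∈ e)

  maxOver-≤⁻ : ∀ g xs {k} → maxOver g xs ≤∞ fin k → ∀ {x} → x ∈ xs → g x ≤∞ fin k
  maxOver-≤⁻ g (y ∷ xs) h (here refl) = proj₁ (max∞-≤⁻ (g y) (maxOver g xs) h)
  maxOver-≤⁻ g (y ∷ xs) h (there x∈) = maxOver-≤⁻ g xs (proj₂ (max∞-≤⁻ (g y) (maxOver g xs) h)) x∈

  maxOver-≤⁺ : ∀ g xs {k} → (∀ x → x ∈ xs → g x ≤∞ fin k) → maxOver g xs ≤∞ fin k
  maxOver-≤⁺ g []       h = fin≤fin z≤n
  maxOver-≤⁺ g (y ∷ xs) h = max∞-≤⁺ (g y) (maxOver g xs) (h y (here refl)) (maxOver-≤⁺ g xs (λ x x∈ → h x (there x∈)))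

  value⇒DWin : ∀ fuel D S {k} → value fuel true D S ≤∞ fin k → DWin k ⟦ D ⟧ ⟦ S ⟧
  value⇒SWin : ∀ fuel D S {k} → value fuel false D S ≤∞ fin k → SWin k ⟦ D ⟧ ⟦ S ⟧
  value⇒DWin zero D S h = if-dominated (dominates D) h inj₁ λ h' → ⊥-elim (∞≰fin (if-lost (isolates S) h'))
  value⇒DWin (suc f) D S h = if-dominated (dominates D) h inj₁ λ h' →
    let _ , h₁ = if-available (any (isFree D S) verts) (if-lost (isolates S) h')
        k' , k≡ , h₂ = 1+∞-≤⁻ _ h₁
        x , x∈ , h₃ = minOver-≤⁻ _ verts h₂
        fx , h₄ = if-available (isFree D S x) h₃
    in inj₂ (subst (λ k → GoodMove k ⟦ D ⟧ ⟦ S ⟧) (sym k≡) (x , x∈ , fx , value⇒SWin f (x ∷ D) S h₄))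
  value⇒SWin zero D S h = if-dominated (dominates D) h inj₁ λ h' → ⊥-elim (∞≰fin (if-lost (isolates S) h'))
  value⇒SWin (suc f) D S h = if-dominated (dominates D) h inj₁ λ h' →
    let some , h₁ = if-available (any (isFree D S) verts) (if-lost (isolates S) h')
    in inj₂ (some , λ y y∈ fy → value⇒DWin f D (y ∷ S) (if-chosen (isFree D S y) fy (maxOver-≤⁻ _ verts h₁ y∈)))

  -- The number of free vertices bounds the number of remaining moves.
  #free : List V → List V → ℕ
  #free D S = countᵇ (isFree D S) verts

  eq-refl : ∀ x → ⌊ eq? x x ⌋ ≡ true
  eq-refl x with eq? x x
  ... | yes _ = refl
  ... | no x≢x = ⊥-elim (x≢x refl)

  #free-claimD : ∀ D S {x} → x ∈ verts → isFree D S x ≡ true → #free (x ∷ D) S < #free D S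
  #free-claimD D S {x} x∈ fx = countᵇ-strict (isFree D S) (isFree (x ∷ D) S) verts
    free-after-claim x∈ fx (taken (eq-refl x))
    where
    free-after-claim : ∀ v → isFree (x ∷ D) S v ≡ true → isFree D S v ≡ true
    free-after-claim v e with ⌊ eq? v x ⌋
    ... | false = e
    ... | true  = ⊥-elim (true≢false (sym e))
    taken : ∀ {a} → a ≡ true → not ((a ∨ elem x D) ∨ elem x S) ≡ false
    taken refl = refl

  #free-claimS : ∀ D S {x} → x ∈ verts → isFree D S x ≡ true → #free D (x ∷ S) < #free D S
  #free-claimS D S {x} x∈ fx = countᵇ-strict (isFree D S) (isFree D (x ∷ S)) verts
    (free-antitone {⟦ D ⟧} (⊆-insert x)) x∈ fx (taken (elem x D) (eq-refl x))
    where
    taken : ∀ d {a} → a ≡ true → not (d ∨ (a ∨ elem x S)) ≡ false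
    taken false refl = refl
    taken true  refl = refl

  no-free : ∀ D S {x} → x ∈ verts → isFree D S x ≡ true → #free D S ≤ 0 → ⊥
  no-free D S x∈ fx c = ℕₚ.<⇒≱ (countᵇ-pos _ verts x∈ fx) c

  DWin⇒value : ∀ fuel D S {k} → DWin k ⟦ D ⟧ ⟦ S ⟧ → Disjoint ⟦ D ⟧ ⟦ S ⟧ → #free D S ≤ fuel → value fuel true D S ≤∞ fin k
  SWin⇒value : ∀ fuel D S {k} → SWin k ⟦ D ⟧ ⟦ S ⟧ → Disjoint ⟦ D ⟧ ⟦ S ⟧ → #free D S ≤ fuel → value fuel false D S ≤∞ fin k
  DWin⇒value fuel D S (inj₁ d) dj c = if-dominated⁺ (dominates D) λ nd → ⊥-elim (true≢false (trans (sym d) nd))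
  DWin⇒value fuel D S {zero} (inj₂ ()) dj c
  DWin⇒value zero D S {suc k} (inj₂ (x , x∈ , fx , _)) dj c = ⊥-elim (no-free D S x∈ fx c)
  DWin⇒value (suc f) D S {suc k} w@(inj₂ (x , x∈ , fx , sw)) dj c = if-dominated⁺ (dominates D) λ _ →
    if-lost⁺ (isolates S) (¬-not (DWin⇒¬isolating (suc k) w dj))
      (if-available⁺ (any (isFree D S) verts) (any-intro _ verts x∈ fx)
        (1+∞-≤⁺ _ (minOver-≤⁺ _ verts x∈ (if-available⁺ (isFree D S x) fx
          (SWin⇒value f (x ∷ D) S sw (Disjoint-insertˡ x fx dj) (ℕₚ.≤-pred (ℕₚ.≤-trans (#free-claimD D S x∈ fx) c)))))))
  SWin⇒value fuel D S (inj₁ d) dj c = if-dominated⁺ (dominates D) λ nd → ⊥-elim (true≢false (trans (sym d) nd))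
  SWin⇒value zero D S (inj₂ (some , _)) dj c =
    let x , x∈ , fx = any-elim _ verts some in ⊥-elim (no-free D S x∈ fx c)
  SWin⇒value (suc f) D S {k} w@(inj₂ (some , h)) dj c = if-dominated⁺ (dominates D) λ _ →
    if-lost⁺ (isolates S) (¬-not (SWin⇒¬isolating k w dj))
      (if-available⁺ (any (isFree D S) verts) some (maxOver-≤⁺ _ verts λ y y∈ → if-chosen⁺ (isFree D S y) λ fy →
        DWin⇒value f D (y ∷ S) (h y y∈ fy) (Disjoint-insertʳ y fy dj) (ℕₚ.≤-pred (ℕₚ.≤-trans (#free-claimS D S y∈ fy) c))))

  γ⇒DWin : ∀ {k} → γMB G ≤∞ fin k → DWin k ∅ ∅
  γ⇒DWin = value⇒DWin (length verts) [] []

  γ'⇒SWin : ∀ {k} → γ'MB G ≤∞ fin k → SWin k ∅ ∅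
  γ'⇒SWin = value⇒SWin (length verts) [] []

  DWin⇒γ : ∀ {k} → DWin k ∅ ∅ → γMB G ≤∞ fin k
  DWin⇒γ w = DWin⇒value (length verts) [] [] w (λ _ ()) (countᵇ≤length _ verts)

Complete : Graph → Set
Complete G = ∀ v → v ∈ Graph.verts G

record Embedding (H G : Graph) : Set where
  field
    embed : Graph.V H → Graph.V G
    embed-injective : ∀ {h h'} → embed h ≡ embed h' → h ≡ h'
    embed-adj : ∀ h h' → Graph.adj H h h' ≡ true → Graph.adj G (embed h) (embed h') ≡ true

record Partition (G : Graph) (c : ℕ) : Set₁ where
  field
    part : Fin (suc c) → Graph
    emb  : ∀ i → Embedding (part i) G

  ι : ∀ i → Graph.V (part i) → Graph.V G
  ι i = Embedding.embed (emb i)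

  field
    disjoint : ∀ i j {h h'} → ι i h ≡ ι j h' → i ≡ j
    cover    : ∀ v → ∃[ i ] ∃[ h ] ι i h ≡ v

Fin-pos : ∀ {n} → Fin n → 0 < n
Fin-pos {suc n} _ = s≤s z≤n

total : ∀ {n} → Vector ℕ n → ℕ
total = foldr _+_ 0

total-spend : ∀ {n} (kk : Vector ℕ n) j {k'} → kk j ≡ suc k' → total kk ≡ suc (total (updateAt kk j (const k')))
total-spend kk fzero    e = cong (_+ total (tail kk)) e
total-spend kk (fsuc j) e = trans (cong (head kk +_) (total-spend (tail kk) j e)) (ℕₚ.+-suc _ _)

total-const : ∀ n b → total {n} (const b) ≡ n * b
total-const zero    b = refl
total-const (suc n) b = cong (b +_) (total-const n b)

-- The splitting strategy.  Dominator keeps, for each part, a budget and a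
-- winning strategy there; one part (the "active" one) has Dominator to
-- move, all others have Staller to move.
module Splitting {G : Graph} {c : ℕ} (Π : Partition G c)
                 (G-complete : Complete G) (parts-complete : ∀ i → Complete (Partition.part Π i)) where
  open Partition Π
  open Graph G using (verts; eq?)
  open Play G
  module Part (i : Fin (suc c)) = Play (part i)

  restrict : ∀ i → VSet → Part.VSet i
  restrict i p = p ∘ ι i

  restrict-insert-same : ∀ i x p → Part._≐_ i (restrict i (insert (ι i x) p)) (Part.insert i x (restrict i p))
  restrict-insert-same i x p h =
    cong (_∨ p (ι i h)) (⌊⌋-cong (Embedding.embed-injective (emb i)) (cong (ι i)) (eq? (ι i h) (ι i x)) (Graph.eq? (part i) h x))

  restrict-insert-other : ∀ i j x p → j ≢ i → Part._≐_ j (restrict j (insert (ι i x) p)) (restrict j p)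
  restrict-insert-other i j x p j≢i h = cong (_∨ p (ι j h)) (⌊⌋-false (eq? (ι j h) (ι i x)) λ e → j≢i (disjoint j i e))

  dominated-glue : ∀ p → (∀ i → Part.dominated i (restrict i p) ≡ true) → dominated p ≡ true
  dominated-glue p hd = all-intro _ verts λ v _ → by-part (cover v)
    where
    by-part : ∀ {v} → (∃[ i ] ∃[ h ] ι i h ≡ v) → (p v ∨ any (λ u → Graph.adj G v u ∧ p u) verts) ≡ true
    by-part (i , h , refl) with ∨-true⁻ {p (ι i h)} (all-elim _ (Graph.verts (part i)) (hd i) (parts-complete i h))
    ... | inj₁ ph = ∨-trueˡ _ ph
    ... | inj₂ nb with any-elim _ (Graph.verts (part i)) nb
    ...   | u , _ , hu with ∧-true⁻ {Graph.adj (part i) h u} hu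
    ...     | adj-hu , pu = ∨-trueʳ (p (ι i h)) (any-intro _ verts (G-complete (ι i u)) (∧-true⁺ (Embedding.embed-adj (emb i) h u adj-hu) pu))

  undominated-part : ∀ p → dominated p ≡ false → ∃[ j ] Part.dominated j (restrict j p) ≡ false
  undominated-part p nd with Finₚ.any? (λ j → Part.dominated j (restrict j p) ≟ false)
  ... | yes found = found
  ... | no none = ⊥-elim (true≢false (trans (sym (dominated-glue p λ j → ¬-not λ e → none (j , e))) nd))

  -- The invariants, with Staller resp. Dominator to move; K is the
  -- number of moves Dominator may still make.
  SInv : ℕ → VSet → VSet → Set
  SInv K p q = Σ (Vector ℕ (suc c)) λ kk → total kk ≡ K × (∀ j → Part.SWin j (kk j) (restrict j p) (restrict j q))

  DInv : ℕ → VSet → VSet → Set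
  DInv K p q = Σ (Vector ℕ (suc c)) λ kk → total kk ≡ K ×
    ∃[ i ] Part.DWin i (kk i) (restrict i p) (restrict i q) × (∀ j → j ≢ i → Part.SWin j (kk j) (restrict j p) (restrict j q))

  AfterMove : ℕ → VSet → VSet → Set
  AfterMove K p q = ∃[ x ] x ∈ verts × free p q x ≡ true × ∃[ K' ] K ≡ suc K' × SInv K' (insert x p) q

  play : ∀ {K p q} kk j → total kk ≡ K → ∀ k → kk j ≡ k → Part.GoodMove j k (restrict j p) (restrict j q) →
         (∀ l → l ≢ j → Part.SWin l (kk l) (restrict l p) (restrict l q)) → AfterMove K p q
  play kk j tot zero e ()
  play {K} {p} {q} kk j tot (suc k') e (x , _ , fx , sw) others =
    ι j x , G-complete (ι j x) , fx , _ , trans (sym tot) (total-spend kk j e) , updateAt kk j (const k') , refl , invariant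
    where
    invariant : ∀ l → Part.SWin l (updateAt kk j (const k') l) (restrict l (insert (ι j x) p)) (restrict l q)
    invariant l with l Finₚ.≟ j
    ... | yes refl = subst (λ b → Part.SWin l b _ _) (sym (updateAt-updates l kk))
                       (Part.SWin-cong j k' (λ h → sym (restrict-insert-same j x p h)) (λ _ → refl) sw)
    ... | no l≢j  = subst (λ b → Part.SWin l b _ _) (sym (updateAt-minimal l j kk l≢j))
                       (Part.SWin-cong l (kk l) (λ h → sym (restrict-insert-other j l x p l≢j h)) (λ _ → refl) (others l l≢j))

  -- Dominator plays in the active part; if it is already dominated he
  -- answers an imaginary Staller move in an undominated part j instead.
  dominator-move : ∀ {K p q} → DInv K p q → dominated p ≡ false → AfterMove K p q
  dominator-move {p = p} {q} (kk , tot , i , inj₂ mv , others) nd = play {p = p} {q} kk i tot (kk i) refl mv others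
  dominator-move {p = p} {q} (kk , tot , i , inj₁ di , others) nd with undominated-part p nd
  ... | j , ndj with j Finₚ.≟ i
  ...   | yes refl = ⊥-elim (true≢false (trans (sym di) ndj))
  ...   | no j≢i with others j j≢i
  ...     | inj₁ dj = ⊥-elim (true≢false (trans (sym dj) ndj))
  ...     | inj₂ (some , answers) with any-elim _ (Graph.verts (part j)) some
  ...       | y , y∈ , fy with answers y y∈ fy
  ...         | inj₁ dj = ⊥-elim (true≢false (trans (sym dj) ndj))
  ...         | inj₂ mv = play {p = p} {q} kk j tot (kk j) refl (Part.GoodMove-antitone j (kk j) (Part.⊆-insert j y {restrict j q}) mv) others'
    where
    others' : ∀ l → l ≢ j → Part.SWin l (kk l) (restrict l p) (restrict l q)
    others' l l≢j with l Finₚ.≟ i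
    ... | yes refl = inj₁ di
    ... | no l≢i  = others l l≢i

  -- Staller's move y lies in some part i, which becomes the active one.
  staller-move : ∀ {K p q} → SInv K p q → ∀ y → free p q y ≡ true → DInv K p (insert y q)
  staller-move {K} {p} {q} (kk , tot , ws) y fy = activate (cover y)
    where
    activate : (∃[ i ] ∃[ h ] ι i h ≡ y) → DInv K p (insert y q)
    activate (i , h , refl) = kk , tot , i , respond (ws i) , λ l l≢i →
      Part.SWin-cong l (kk l) (λ _ → refl) (λ h' → sym (restrict-insert-other i l h q l≢i h')) (ws l)
      where
      respond : Part.SWin i (kk i) (restrict i p) (restrict i q) → Part.DWin i (kk i) (restrict i p) (restrict i (insert (ι i h) q))
      respond (inj₁ d) = inj₁ d
      respond (inj₂ (_ , answers)) =
        Part.DWin-cong i (kk i) (λ _ → refl) (λ h' → sym (restrict-insert-same i h q h')) (answers h (parts-complete i h) fy)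

  -- While G is undominated some part is undominated, so Staller has a move.
  staller-can-move : ∀ {K p q} → SInv K p q → dominated p ≡ false → any (free p q) verts ≡ true
  staller-can-move {p = p} (kk , _ , ws) nd with undominated-part p nd
  ... | j , ndj with ws j
  ...   | inj₁ dj = ⊥-elim (true≢false (trans (sym dj) ndj))
  ...   | inj₂ (some , _) with any-elim _ (Graph.verts (part j)) some
  ...     | h , _ , fh = any-intro _ verts (G-complete (ι j h)) fh

  DInv⇒DWin : ∀ K {p q} → DInv K p q → DWin K p q
  SInv⇒SWin : ∀ K {p q} → SInv K p q → SWin K p q
  DInv⇒DWin K {p} inv with true-or-false (dominated p)
  ... | inj₁ d  = inj₁ d
  ... | inj₂ nd with dominator-move inv nd
  ...   | x , x∈ , fx , K' , refl , inv' = inj₂ (x , x∈ , fx , SInv⇒SWin K' inv')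
  SInv⇒SWin K {p} {q} inv with true-or-false (dominated p)
  ... | inj₁ d  = inj₁ d
  ... | inj₂ nd = inj₂ (staller-can-move inv nd , λ y _ fy → DInv⇒DWin K (staller-move {p = p} {q} inv y fy))

  split-strategy : ∀ (kk : Vector ℕ (suc c)) → Part.DWin fzero (kk fzero) (Part.∅ fzero) (Part.∅ fzero) →
                   (∀ t → Part.SWin (fsuc t) (kk (fsuc t)) (Part.∅ (fsuc t)) (Part.∅ (fsuc t))) → DWin (total kk) ∅ ∅
  split-strategy kk d s = DInv⇒DWin (total kk) (kk , refl , fzero , d , others)
    where
    others : ∀ j → j ≢ fzero → Part.SWin j (kk j) (restrict j ∅) (restrict j ∅)
    others fzero    j≢0 = ⊥-elim (j≢0 refl)
    others (fsuc t) _   = s t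

partition-bound : ∀ {G c} (Π : Partition G c) → Complete G → (∀ i → Complete (Partition.part Π i)) →
                  ∀ {y} → (∀ t → γ'MB (Partition.part Π (fsuc t)) ≤∞ y) →
                  γMB G ≤∞ γMB (Partition.part Π fzero) +∞ c ·∞ y
partition-bound {G} {c} Π G-complete parts-complete {y} γ'≤y = +∞-·∞-bound c _ y λ a b γ≤a y≤b →
  subst (λ K → γMB G ≤∞ fin K) (cong (a +_) (total-const c b))
    (Adequacy.DWin⇒γ G (split-strategy (budget a b)
      (Adequacy.γ⇒DWin (part fzero) γ≤a)
      (λ t → Adequacy.γ'⇒SWin (part (fsuc t)) (≤∞-trans (γ'≤y t) (y≤b (Fin-pos t))))))
  where
  open Partition Π
  open Splitting Π G-complete parts-complete
  budget : ℕ → ℕ → Vector ℕ (suc c)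
  budget a b fzero    = a
  budget a b (fsuc t) = b

P-complete : ∀ k → Complete (P k)
P-complete k x = ∈-allFin x

□-complete : ∀ {A B} → Complete A → Complete B → Complete (A □ B)
□-complete {A} {B} A-complete B-complete (a , b) =
  ∈-concatMap⁺ (λ g → map (g ,_) (Graph.verts B)) (lose (A-complete a) (∈-map⁺ (a ,_) (B-complete b)))

P□-complete : ∀ k Q → Complete Q → Complete (P k □ Q)
P□-complete k Q = □-complete {P k} {Q} (P-complete k)

module _ {H G : Graph} (f : Embedding H G) where
  open Embedding f

  embed-≟ : ∀ h h' → ⌊ Graph.eq? G (embed h) (embed h') ⌋ ≡ ⌊ Graph.eq? H h h' ⌋
  embed-≟ h h' = ⌊⌋-cong embed-injective (cong embed) _ _

  _□ᴱ_ : (Q : Graph) → Embedding (H □ Q) (G □ Q)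
  _□ᴱ_ Q = record
    { embed           = λ { (h , q) → embed h , q }
    ; embed-injective = λ { {_ , _} {_ , _} e → cong₂ _,_ (embed-injective (cong proj₁ e)) (cong proj₂ e) }
    ; embed-adj       = adj□
    }
    where
    adj□ : ∀ x y → Graph.adj (H □ Q) x y ≡ true → Graph.adj (G □ Q) (embed (proj₁ x) , proj₂ x) (embed (proj₁ y) , proj₂ y) ≡ true
    adj□ (h , q) (h' , q') e rewrite embed-≟ h h' =
      ∨-true-mapʳ {⌊ Graph.eq? H h h' ⌋ ∧ Graph.adj Q q q'} e λ e' →
        let q≡q' , hh' = ∧-true⁻ {⌊ Graph.eq? Q q q' ⌋} e' in ∧-true⁺ q≡q' (embed-adj h h' hh')

_∘ᴱ_ : ∀ {H G K} → Embedding G K → Embedding H G → Embedding H K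
g ∘ᴱ f = record
  { embed           = Embedding.embed g ∘ Embedding.embed f
  ; embed-injective = Embedding.embed-injective f ∘ Embedding.embed-injective g
  ; embed-adj       = λ h h' e → Embedding.embed-adj g _ _ (Embedding.embed-adj f h h' e)
  }

swapᴱ : ∀ {A B} → Embedding (A □ B) (B □ A)
swapᴱ {A} {B} = record
  { embed           = λ { (a , b) → b , a }
  ; embed-injective = λ { {_ , _} {_ , _} e → cong₂ _,_ (cong proj₂ e) (cong proj₁ e) }
  ; embed-adj       = λ { (a , b) (a' , b') e →
      trans (∨-comm (⌊ Graph.eq? B b b' ⌋ ∧ Graph.adj A a a') (⌊ Graph.eq? A a a' ⌋ ∧ Graph.adj B b b')) e }
  }

transport : ∀ {G G' c} → Partition G c → (φ : Embedding G G') → (∀ v → ∃[ u ] Embedding.embed φ u ≡ v) → Partition G' c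
transport Π φ onto = record
  { part     = part
  ; emb      = λ i → φ ∘ᴱ emb i
  ; disjoint = λ i j e → disjoint i j (Embedding.embed-injective φ e)
  ; cover    = λ v → let u , φu≡v = onto v ; i , h , ιh≡u = cover u
                     in i , h , trans (cong (Embedding.embed φ) ιh≡u) φu≡v
  }
  where open Partition Π

_□ᴾ_ : ∀ {G c} → Partition G c → (Q : Graph) → Partition (G □ Q) c
Π □ᴾ Q = record
  { part     = λ i → part i □ Q
  ; emb      = λ i → emb i □ᴱ Q
  ; disjoint = λ { i j {_ , _} {_ , _} e → disjoint i j (cong proj₁ e) }
  ; cover    = λ { (v , q) → let i , h , ιh≡v = cover v in i , (h , q) , cong (_, q) ιh≡v }
  }
  where open Partition Π

P-adj-shift : ∀ {k N} (f : Fin k → Fin N) d → (∀ a → toℕ (f a) ≡ d + toℕ a) →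
              ∀ a a' → Graph.adj (P N) (f a) (f a') ≡ Graph.adj (P k) a a'
P-adj-shift f d toℕ-f a a' rewrite toℕ-f a | toℕ-f a' = cong₂ _∨_ (shifted a a') (shifted a' a)
  where
  shifted : ∀ x y → ⌊ suc (d + toℕ x) ℕₚ.≟ d + toℕ y ⌋ ≡ ⌊ suc (toℕ x) ℕₚ.≟ toℕ y ⌋
  shifted x y = ⌊⌋-cong (λ e → ℕₚ.+-cancelˡ-≡ d _ _ (trans (ℕₚ.+-suc d _) e))
                        (λ e → trans (sym (ℕₚ.+-suc d _)) (cong (d +_) e)) _ _

divmod₂-unique : ∀ a b r s → r < 2 → s < 2 → a * 2 + r ≡ b * 2 + s → a ≡ b × r ≡ s
divmod₂-unique zero    zero    r s _ _ e = refl , e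
divmod₂-unique zero    (suc b) .(suc (suc (b * 2 + s))) s (s≤s (s≤s ())) _ refl
divmod₂-unique (suc a) zero    r .(suc (suc (a * 2 + r))) _ (s≤s (s≤s ())) refl
divmod₂-unique (suc a) (suc b) r s r<2 s<2 e with divmod₂-unique a b r s r<2 s<2 (ℕₚ.suc-injective (ℕₚ.suc-injective e))
... | refl , r≡s = refl , r≡s

within-pairs : ∀ {t h a} → t < h → a < 2 → t * 2 + a < h * 2
within-pairs {t} {h} t<h a<2 =
  ℕₚ.≤-trans (ℕₚ.+-monoʳ-< (t * 2) a<2) (subst (_≤ h * 2) (ℕₚ.+-comm 2 (t * 2)) (ℕₚ.*-monoˡ-≤ 2 t<h))

-- The vertices off + 2t and off + 2t + 1 (t < h) of the path P N, with
-- N = off + 2h, form h disjoint copies of P 2 covering all vertices ≥ off.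
module Pairs (N h off : ℕ) (N≡ : N ≡ off + h * 2) where

  pos< : ∀ (t : Fin h) (a : Fin 2) → off + toℕ t * 2 + toℕ a < N
  pos< t a = subst (_< N) (sym (ℕₚ.+-assoc off _ _)) (subst (off + (toℕ t * 2 + toℕ a) <_) (sym N≡)
               (ℕₚ.+-monoʳ-< off (within-pairs (Finₚ.toℕ<n t) (Finₚ.toℕ<n a))))

  vertex : Fin h → Fin 2 → Fin N
  vertex t a = fromℕ< (pos< t a)

  toℕ-vertex : ∀ t a → toℕ (vertex t a) ≡ off + toℕ t * 2 + toℕ a
  toℕ-vertex t a = Finₚ.toℕ-fromℕ< (pos< t a)

  vertex-injective : ∀ {t t' a a'} → vertex t a ≡ vertex t' a' → t ≡ t' × a ≡ a'
  vertex-injective {t} {t'} {a} {a'} e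
    with divmod₂-unique (toℕ t) (toℕ t') (toℕ a) (toℕ a') (Finₚ.toℕ<n a) (Finₚ.toℕ<n a')
           (ℕₚ.+-cancelˡ-≡ off _ _ (trans (sym (ℕₚ.+-assoc off _ _))
             (trans (sym (toℕ-vertex t a)) (trans (cong toℕ e) (trans (toℕ-vertex t' a') (ℕₚ.+-assoc off _ _))))))
  ... | t≡t' , a≡a' = Finₚ.toℕ-injective t≡t' , Finₚ.toℕ-injective a≡a'

  off≤vertex : ∀ t a → off ≤ toℕ (vertex t a)
  off≤vertex t a = subst (off ≤_) (sym (toℕ-vertex t a)) (ℕₚ.≤-trans (ℕₚ.m≤m+n off _) (ℕₚ.m≤m+n _ _))

  vertex-cover : ∀ (x : Fin N) → off ≤ toℕ x → ∃[ t ] ∃[ a ] vertex t a ≡ x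
  vertex-cover x off≤x = fromℕ< t<h , fromℕ< a<2 , Finₚ.toℕ-injective (begin
      toℕ (vertex (fromℕ< t<h) (fromℕ< a<2))  ≡⟨ toℕ-vertex (fromℕ< t<h) (fromℕ< a<2) ⟩
      off + toℕ (fromℕ< t<h) * 2 + toℕ (fromℕ< a<2)
        ≡⟨ cong₂ (λ u w → off + u * 2 + w) (Finₚ.toℕ-fromℕ< t<h) (Finₚ.toℕ-fromℕ< a<2) ⟩
      off + y / 2 * 2 + y % 2                 ≡⟨ ℕₚ.+-assoc off _ _ ⟩
      off + (y / 2 * 2 + y % 2)               ≡⟨ cong (off +_) (trans (ℕₚ.+-comm _ (y % 2)) (sym (m≡m%n+[m/n]*n y 2))) ⟩
      off + y                                 ≡⟨ ℕₚ.m+[n∸m]≡n off≤x ⟩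
      toℕ x                                   ∎)
    where
    open ≡-Reasoning
    y = toℕ x ∸ off
    y<h*2 : y < h * 2
    y<h*2 = ℕₚ.+-cancelˡ-< off _ _
              (subst (_< off + h * 2) (sym (ℕₚ.m+[n∸m]≡n off≤x)) (subst (toℕ x <_) N≡ (Finₚ.toℕ<n x)))
    t<h : y / 2 < h
    t<h = m<n*o⇒m/o<n y<h*2
    a<2 : y % 2 < 2
    a<2 = m%n<n y 2

  pair : Fin h → Embedding (P 2) (P N)
  pair t = record
    { embed           = vertex t
    ; embed-injective = λ {a} {a'} e → proj₂ (vertex-injective {t} {t} {a} {a'} e)
    ; embed-adj       = λ a a' e → trans (P-adj-shift (vertex t) (off + toℕ t * 2) (toℕ-vertex t) a a') e
    }

pairs : ∀ c → Partition (P (suc c * 2)) c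
pairs c = record
  { part     = const (P 2)
  ; emb      = pair
  ; disjoint = λ i j e → proj₁ (vertex-injective e)
  ; cover    = λ x → vertex-cover x z≤n
  }
  where open Pairs (suc c * 2) (suc c) 0 refl

first-row : ∀ {k} Q → Embedding Q (P (suc k) □ Q)
first-row Q = record
  { embed           = fzero ,_
  ; embed-injective = cong proj₂
  ; embed-adj       = λ q q' e → ∨-trueˡ _ e
  }

row+pairs : ∀ c Q → Partition (P (suc (c * 2)) □ Q) c
row+pairs c Q = record
  { part     = λ { fzero → Q ; (fsuc t) → P 2 □ Q }
  ; emb      = λ { fzero → first-row Q ; (fsuc t) → pair t □ᴱ Q }
  ; disjoint = disjoint
  ; cover    = λ { (fzero , q) → fzero , q , refl
                 ; (fsuc x , q) → let t , a , e = vertex-cover (fsuc x) (s≤s z≤n) in fsuc t , (a , q) , cong (_, q) e }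
  }
  where
  open Pairs (suc (c * 2)) c 1 refl
  ¬first : ∀ t a → fzero ≢ vertex t a
  ¬first t a e with subst (λ v → 1 ≤ toℕ v) (sym e) (off≤vertex t a)
  ... | ()
  disjoint : ∀ i j {h h'} → _ → i ≡ j
  disjoint fzero    fzero     e = refl
  disjoint fzero    (fsuc t)  {h' = a , _} e = ⊥-elim (¬first t a (cong proj₁ e))
  disjoint (fsuc t) fzero     {h = a , _} e = ⊥-elim (¬first t a (sym (cong proj₁ e)))
  disjoint (fsuc t) (fsuc t') {a , _} {a' , _} e = cong fsuc (proj₁ (vertex-injective (cong proj₁ e)))

even-bound : ∀ c {Q} → Complete Q → γMB (P (suc c * 2) □ Q) ≤∞ γMB (P 2 □ Q) +∞ c ·∞ γ'MB (P 2 □ Q)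
even-bound c {Q} Q-complete =
  partition-bound (pairs c □ᴾ Q) (P□-complete (suc c * 2) Q Q-complete) (λ _ → P□-complete 2 Q Q-complete) (λ _ → ≤∞-refl)

odd-bound : ∀ c {Q} → Complete Q → γMB (P (suc (c * 2)) □ Q) ≤∞ γMB Q +∞ c ·∞ γ'MB (P 2 □ Q)
odd-bound c {Q} Q-complete =
  partition-bound (row+pairs c Q) (P□-complete (suc (c * 2)) Q Q-complete) parts-complete (λ _ → ≤∞-refl)
  where
  parts-complete : ∀ i → Complete (Partition.part (row+pairs c Q) i)
  parts-complete fzero    = Q-complete
  parts-complete (fsuc t) = P□-complete 2 Q Q-complete

-- (iii)  the transposed form of (i): strips of two columns.
even-bound-transposed : ∀ c {Q} → Complete Q → γMB (Q □ P (suc c * 2)) ≤∞ γMB (P 2 □ Q) +∞ c ·∞ γ'MB (P 2 □ Q)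
even-bound-transposed c {Q} Q-complete =
  partition-bound (transport (pairs c □ᴾ Q) (swapᴱ {P (suc c * 2)} {Q}) (λ { (q , x) → (x , q) , refl }))
    (□-complete {Q} {P (suc c * 2)} Q-complete (P-complete (suc c * 2))) (λ _ → P□-complete 2 Q Q-complete) (λ _ → ≤∞-refl)

-- The bounds are proved for grids of side length suc c * 2 resp.
-- suc (c * 2); they transfer to any equal side length.
resize : ∀ (G : ℕ → Graph) {k k' b} → k ≡ k' → γMB (G k) ≤∞ b → γMB (G k') ≤∞ b
resize G refl h = h

even-halves : ∀ {m} → 2 ∣ m → 0 < m → suc (m / 2 ∸ 1) * 2 ≡ m
even-halves {m} 2∣m 0<m with m / 2 | m/n*n≡m {m} {2} 2∣m
... | zero  | 0≡m = ⊥-elim (ℕₚ.<⇒≢ 0<m 0≡m)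
... | suc h | e   = e

odd-halves : ∀ {m} → ¬ 2 ∣ m → suc (m / 2 * 2) ≡ m
odd-halves {m} ¬2∣m with m % 2 | m%n<n m 2 | m≡m%n+[m/n]*n m 2 | m%n≡0⇒n∣m m 2
... | zero        | _                | _ | 2∣m = ⊥-elim (¬2∣m (2∣m refl))
... | suc zero    | _                | e | _   = sym e
... | suc (suc r) | s≤s (s≤s ())     | _ | _

corollary1 : (m n : ℕ) → 3 ≤ m → m ≤ n →
    (2 ∣ m → γMB (P m □ P n) ≤∞ γMB (P 2 □ P n) +∞ (m / 2 ∸ 1) ·∞ γ'MB (P 2 □ P n))
    × (¬ 2 ∣ m → ¬ 2 ∣ n → γMB (P m □ P n) ≤∞ γMB (P n) +∞ (m / 2) ·∞ γ'MB (P 2 □ P n))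
    × (¬ 2 ∣ m → 2 ∣ n → γMB (P m □ P n) ≤∞ γMB (P 2 □ P m) +∞ (n / 2 ∸ 1) ·∞ γ'MB (P 2 □ P m))
corollary1 m n 3≤m m≤n =
    (λ 2∣m → resize (λ k → P k □ P n) (even-halves 2∣m 0<m) (even-bound (m / 2 ∸ 1) {P n} (P-complete n)))
  , (λ ¬2∣m _ → resize (λ k → P k □ P n) (odd-halves ¬2∣m) (odd-bound (m / 2) {P n} (P-complete n)))
  , (λ _ 2∣n → resize (λ k → P m □ P k) (even-halves 2∣n 0<n) (even-bound-transposed (n / 2 ∸ 1) {P m} (P-complete m)))
  where
  0<m : 0 < m
  0<m = ℕₚ.≤-trans (s≤s z≤n) 3≤m
  0<n : 0 < n
  0<n = ℕₚ.≤-trans 0<m m≤n
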